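{- There is no finite simple graph $\Gamma$ with at least one vertex such that $\Gamma\cong\tilde\Gamma$, where $\tilde\Gamma$ is the prime graph of $SEP(\Gamma)$.
   Context: Two vertices $u,v$ of a graph are structurally equivalent if the transposition $(u\,v)$ (swapping $u,v$, fixing other vertices) is an automorphism; $SEP(\Gamma)=\langle\{(u\,v) : (u\,v)\in \mathrm{Aut}(\Gamma)\}\rangle$. The prime graph of a finite group $G$ has as vertices the primes dividing $|G|$, distinct primes $p,q$ being adjacent iff $G$ has an element of order $pq$. -}

module Defs where

open import Data.Nat using (ℕ; zero; suc; _*_; _≤_; _<_)
open import Data.Nat.Divisibility using (_∣_)
open import Data.Nat.Primality using (Prime)
open import Data.Fin using (Fin)
open import Data.Vec using (Vec; tabulate; lookup; allFin)
open import Data.List using (List; length)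
open import Data.List.Membership.Propositional using (_∈_)
open import Data.List.Relation.Unary.Unique.Propositional using (Unique)
open import Data.Product using (Σ; _×_; ∃)
open import Function.Bundles using (_⇔_)
open import Relation.Binary.PropositionalEquality using (_≡_; _≢_)
open import Relation.Nullary using (¬_)
open import Data.Fin using (_≟_)
open import Relation.Nullary.Decidable using (does)
open import Data.Bool using (if_then_else_)

record SimpleGraph (n : ℕ) : Set₁ where
  field
    Adj   : Fin n → Fin n → Set
    sym   : ∀ {x y} → Adj x y → Adj y x
    irref : ∀ {x} → ¬ Adj x x

open SimpleGraph public

-- Maps Fin n → Fin n are represented as vectors (so equality is decidable ≡).
Map : ℕ → Set
Map n = Vec (Fin n) n

e : ∀ {n} → Map n
e {n} = allFin n

_∘ₚ_ : ∀ {n} → Map n → Map n → Map n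
σ ∘ₚ τ = tabulate (λ i → lookup σ (lookup τ i))

_^ₚ_ : ∀ {n} → Map n → ℕ → Map n
σ ^ₚ zero = e
σ ^ₚ suc k = σ ∘ₚ (σ ^ₚ k)

swapFin : ∀ {n} → Fin n → Fin n → Fin n → Fin n
swapFin u v x = if does (x ≟ u) then v else (if does (x ≟ v) then u else x)

transp : ∀ {n} → Fin n → Fin n → Map n
transp u v = tabulate (swapFin u v)

-- σ is an automorphism of Γ (σ is assumed to be a permutation here)
IsAut : ∀ {n} → SimpleGraph n → Map n → Set
IsAut Γ σ = ∀ x y → Adj Γ x y ⇔ Adj Γ (lookup σ x) (lookup σ y)

StructEquiv : ∀ {n} → SimpleGraph n → Fin n → Fin n → Set
StructEquiv Γ u v = u ≢ v × IsAut Γ (transp u v)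

-- SEP(Γ): the subgroup of Sym(n) generated by the automorphic transpositions
-- (smallest set containing them, the identity, closed under product and inverse).
data InSEP {n : ℕ} (Γ : SimpleGraph n) : Map n → Set where
  sep-id  : InSEP Γ e
  sep-gen : ∀ u v → StructEquiv Γ u v → InSEP Γ (transp u v)
  sep-mul : ∀ {σ τ} → InSEP Γ σ → InSEP Γ τ → InSEP Γ (σ ∘ₚ τ)
  sep-inv : ∀ {σ τ} → InSEP Γ σ → τ ∘ₚ σ ≡ e → InSEP Γ τ

HasOrder : ∀ {n} → SimpleGraph n → ℕ → Set
HasOrder {n} Γ N =
  Σ (List (Map n)) λ l →
    Unique l × (∀ σ → σ ∈ l ⇔ InSEP Γ σ) × length l ≡ N

ElemOrder : ∀ {n} → Map n → ℕ → Set
ElemOrder σ k = 1 ≤ k × σ ^ₚ k ≡ e × (∀ j → 1 ≤ j → j < k → σ ^ₚ j ≢ e)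

PGVertex : ℕ → ℕ → Set
PGVertex N p = Prime p × p ∣ N

PGAdj : ∀ {n} → SimpleGraph n → ℕ → ℕ → Set
PGAdj {n} Γ p q = p ≢ q × ∃ λ (σ : Map n) → InSEP Γ σ × ElemOrder σ (p * q)

IsoToPrimeGraph : ∀ {n} → SimpleGraph n → ℕ → Set
IsoToPrimeGraph {n} Γ N =
  Σ (Fin n → ℕ) λ f →
    (∀ i → PGVertex N (f i)) ×
    (∀ i j → f i ≡ f j → i ≡ j) ×
    (∀ p → PGVertex N p → ∃ λ i → f i ≡ p) ×
    (∀ i j → Adj Γ i j ⇔ PGAdj Γ (f i) (f j))

-- A prime p dividing the order of a permutation group G on n points satisfies p ≤ n: in the
-- stabiliser chain G = G₀ ≥ G_{x₁} ≥ G_{x₁x₂} ≥ … ≥ 1, orbit–stabiliser makes each index the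
-- size of an orbit, hence at most n, and p divides one of these indices. SEP(Γ) permutes the
-- n vertices of Γ, so its prime graph has at most n - 1 vertices (all primes in 2 … n) and
-- cannot be isomorphic to Γ.
module Submission where

open import Defs hiding (sym)
open import Data.Empty using (⊥-elim)
open import Data.Fin using (Fin; zero; suc; fromℕ<) renaming (_≟_ to _≟ᶠ_)
open import Data.Fin.Properties using (injective⇒≤; fromℕ<-injective)
open import Data.List as List using (List; []; _∷_; length; filter; map; allFin)
open import Data.List.Properties using (map-cong; length-tabulate)
open import Data.List.Membership.Propositional using (_∈_)
open import Data.List.Membership.Propositional.Properties using (∈-filter⁺; ∈-filter⁻; ∈-allFin; ∈-lookup; ∈-length)
open import Data.List.Membership.Setoid.Properties using (index-injective)
open import Data.List.Relation.Unary.Any using (here; there)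
open import Data.List.Relation.Unary.All as All using (All; []; _∷_)
open import Data.List.Relation.Unary.AllPairs using ([]; _∷_)
open import Data.List.Relation.Unary.Unique.Propositional using (Unique)
import Data.List.Relation.Unary.Unique.Propositional.Properties as Unique
open import Data.Nat using (ℕ; zero; suc; _+_; _*_; _∸_; _≤_; _<_; z≤n; s≤s; NonZero; >-nonZero; nonTrivial⇒n>1)
open import Data.Nat.Divisibility using (_∣_; ∣⇒≤; ∣1⇒≡1)
open import Data.Nat.ListAction using (sum)
open import Data.Nat.Primality using (Prime; euclidsLemma; prime⇒nonTrivial; ¬prime[1])
import Data.Nat.Properties as ℕ
open import Algebra.Properties.CommutativeSemigroup ℕ.+-commutativeSemigroup using (interchange)
open import Data.Product using (∃; _×_; _,_; proj₁; proj₂)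
open import Data.Sum using (_⊎_; inj₁; inj₂; map₁)
open import Data.Vec using (lookup; tabulate)
open import Data.Vec.Properties using (lookup∘tabulate; lookup-allFin; tabulate∘lookup; tabulate-cong)
open import Function using (_∘_; id)
open import Function.Bundles using (_⇔_; Equivalence)
open import Relation.Binary.PropositionalEquality
open import Relation.Nullary using (¬_; Dec; yes; no)
open import Relation.Nullary.Decidable using (dec-true; dec-false)

-- Counting lemmas for lists

module _ {A : Set} where

  unique-lookup-injective : ∀ {xs : List A} → Unique xs →
    ∀ {i j} → List.lookup xs i ≡ List.lookup xs j → i ≡ j
  unique-lookup-injective (_  ∷ _) {zero}  {zero}  _  = refl
  unique-lookup-injective (x∉ ∷ _) {zero}  {suc j} eq = ⊥-elim (All.lookup x∉ (∈-lookup j) eq)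
  unique-lookup-injective (x∉ ∷ _) {suc i} {zero}  eq = ⊥-elim (All.lookup x∉ (∈-lookup i) (sym eq))
  unique-lookup-injective (_  ∷ u) {suc i} {suc j} eq = cong suc (unique-lookup-injective u eq)

  length-≤-by-injection : {B : Set} {xs : List A} {ys : List B} → Unique xs →
    (g : A → B) → (∀ {a b} → g a ≡ g b → a ≡ b) → (∀ {a} → a ∈ xs → g a ∈ ys) →
    length xs ≤ length ys
  length-≤-by-injection u g g-injective into = injective⇒≤ λ {i} {j} eq →
    unique-lookup-injective u
      (g-injective (index-injective (setoid _) (into (∈-lookup i)) (into (∈-lookup j)) eq))

indicator : {P : Set} → Dec P → ℕ
indicator (yes _) = 1
indicator (no _)  = 0

sum-map-+ : {B : Set} (f g : B → ℕ) (ys : List B) →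
  sum (map (λ y → f y + g y) ys) ≡ sum (map f ys) + sum (map g ys)
sum-map-+ f g []       = refl
sum-map-+ f g (y ∷ ys) = trans (cong (f y + g y +_) (sum-map-+ f g ys))
                               (interchange (f y) (g y) (sum (map f ys)) (sum (map g ys)))

module _ {n : ℕ} where

  sum-indicator-∉ : (z : Fin n) (ys : List (Fin n)) → All (z ≢_) ys →
    sum (map (λ y → indicator (z ≟ᶠ y)) ys) ≡ 0
  sum-indicator-∉ z []       []         = refl
  sum-indicator-∉ z (y ∷ ys) (z≢y ∷ z∉) with z ≟ᶠ y
  ... | yes z≡y = ⊥-elim (z≢y z≡y)
  ... | no  _   = sum-indicator-∉ z ys z∉

  sum-indicator-∈ : (z : Fin n) (ys : List (Fin n)) → Unique ys → z ∈ ys →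
    sum (map (λ y → indicator (z ≟ᶠ y)) ys) ≡ 1
  sum-indicator-∈ z (y ∷ ys) (y∉ ∷ u) z∈ with z ≟ᶠ y | z∈
  ... | yes refl | _          = cong suc (sum-indicator-∉ z ys y∉)
  ... | no  z≢y  | here z≡y   = ⊥-elim (z≢y z≡y)
  ... | no  _    | there z∈ys = sum-indicator-∈ z ys u z∈ys

  fibre : {A : Set} → (A → Fin n) → List A → Fin n → List A
  fibre φ xs y = filter (λ a → φ a ≟ᶠ y) xs

  length-≡-sum-of-fibres : {A : Set} (φ : A → Fin n) (xs : List A) →
    length xs ≡ sum (map (length ∘ fibre φ xs) (allFin n))
  length-≡-sum-of-fibres φ [] = sym (sum-zeros (allFin n))
    where
    sum-zeros : (ys : List (Fin n)) → sum (map (λ _ → 0) ys) ≡ 0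
    sum-zeros []       = refl
    sum-zeros (_ ∷ ys) = sum-zeros ys
  length-≡-sum-of-fibres φ (a ∷ xs) = sym (begin
      sum (map (length ∘ fibre φ (a ∷ xs)) (allFin n))
    ≡⟨ cong sum (map-cong fibre-∷ (allFin n)) ⟩
      sum (map (λ y → indicator (φ a ≟ᶠ y) + length (fibre φ xs y)) (allFin n))
    ≡⟨ sum-map-+ (λ y → indicator (φ a ≟ᶠ y)) (length ∘ fibre φ xs) (allFin n) ⟩
      sum (map (λ y → indicator (φ a ≟ᶠ y)) (allFin n)) + sum (map (length ∘ fibre φ xs) (allFin n))
    ≡⟨ cong₂ _+_ (sum-indicator-∈ (φ a) (allFin n) (Unique.allFin⁺ n) (∈-allFin (φ a)))
                 (sym (length-≡-sum-of-fibres φ xs)) ⟩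
      suc (length xs) ∎)
    where
    open ≡-Reasoning
    fibre-∷ : ∀ y → length (fibre φ (a ∷ xs) y) ≡ indicator (φ a ≟ᶠ y) + length (fibre φ xs y)
    fibre-∷ y with φ a ≟ᶠ y
    ... | yes _ = refl
    ... | no  _ = refl

sum-of-0-or-s : {B : Set} (f : B → ℕ) (s : ℕ) (ys : List B) → (∀ y → f y ≡ 0 ⊎ f y ≡ s) →
  ∃ λ c → c ≤ length ys × sum (map f ys) ≡ c * s
sum-of-0-or-s f s []       _      = 0 , z≤n , refl
sum-of-0-or-s f s (y ∷ ys) f-values with sum-of-0-or-s f s ys f-values | f-values y
... | c , c≤ , eq | inj₁ fy≡0 = c     , ℕ.m≤n⇒m≤1+n c≤ , cong₂ _+_ fy≡0 eq
... | c , c≤ , eq | inj₂ fy≡s = suc c , s≤s c≤        , cong₂ _+_ fy≡s eq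

length-by-equal-fibres : {n : ℕ} {A : Set} (φ : A → Fin n) (xs : List A) (s : ℕ) →
  (∀ y {a} → a ∈ fibre φ xs y → length (fibre φ xs y) ≡ s) →
  ∃ λ c → c ≤ n × length xs ≡ c * s
length-by-equal-fibres {n} φ xs s equal =
  let c , c≤ , eq = sum-of-0-or-s (length ∘ fibre φ xs) s (allFin n) empty-or-s
  in c , ℕ.≤-trans c≤ (ℕ.≤-reflexive (length-tabulate _)) , trans (length-≡-sum-of-fibres φ xs) eq
  where
  empty-or-s : ∀ y → length (fibre φ xs y) ≡ 0 ⊎ length (fibre φ xs y) ≡ s
  empty-or-s y with fibre φ xs y in fibre≡
  ... | []    = inj₁ refl
  ... | a ∷ _ = inj₂ (trans (cong length (sym fibre≡)) (equal y (subst (a ∈_) (sym fibre≡) (here refl))))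

-- Permutations of Fin n

record AreInverse {n} (σ τ : Map n) : Set where
  constructor inverses
  field
    after  : ∀ i → lookup τ (lookup σ i) ≡ i
    before : ∀ i → lookup σ (lookup τ i) ≡ i

Fixes : ∀ {n} → Map n → Fin n → Set
Fixes σ x = lookup σ x ≡ x

module _ {n : ℕ} where

  lookup-∘ₚ : (σ τ : Map n) (i : Fin n) → lookup (σ ∘ₚ τ) i ≡ lookup σ (lookup τ i)
  lookup-∘ₚ σ τ = lookup∘tabulate _

  lookup-e : (i : Fin n) → lookup e i ≡ i
  lookup-e = lookup-allFin

  Map-ext : {σ τ : Map n} → (∀ i → lookup σ i ≡ lookup τ i) → σ ≡ τ
  Map-ext {σ} {τ} eq = begin
    σ                  ≡⟨ tabulate∘lookup σ ⟨
    tabulate (lookup σ) ≡⟨ tabulate-cong eq ⟩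
    tabulate (lookup τ) ≡⟨ tabulate∘lookup τ ⟩
    τ                  ∎
    where open ≡-Reasoning

  e-inverse : AreInverse (e {n}) e
  e-inverse = inverses e∘e e∘e
    where
    e∘e : ∀ i → lookup e (lookup e i) ≡ i
    e∘e i = trans (lookup-e _) (lookup-e i)

  ∘ₚ-inverse : ∀ {σ σ′ τ τ′ : Map n} → AreInverse σ σ′ → AreInverse τ τ′ →
    AreInverse (σ ∘ₚ τ) (τ′ ∘ₚ σ′)
  ∘ₚ-inverse {σ} {σ′} {τ} {τ′} (inverses σ′σ σσ′) (inverses τ′τ ττ′) = inverses left right
    where
    open ≡-Reasoning
    left : ∀ i → lookup (τ′ ∘ₚ σ′) (lookup (σ ∘ₚ τ) i) ≡ i
    left i = begin
      lookup (τ′ ∘ₚ σ′) (lookup (σ ∘ₚ τ) i)          ≡⟨ lookup-∘ₚ τ′ σ′ _ ⟩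
      lookup τ′ (lookup σ′ (lookup (σ ∘ₚ τ) i))      ≡⟨ cong (lookup τ′ ∘ lookup σ′) (lookup-∘ₚ σ τ i) ⟩
      lookup τ′ (lookup σ′ (lookup σ (lookup τ i)))  ≡⟨ cong (lookup τ′) (σ′σ _) ⟩
      lookup τ′ (lookup τ i)                         ≡⟨ τ′τ i ⟩
      i                                              ∎
    right : ∀ i → lookup (σ ∘ₚ τ) (lookup (τ′ ∘ₚ σ′) i) ≡ i
    right i = begin
      lookup (σ ∘ₚ τ) (lookup (τ′ ∘ₚ σ′) i)          ≡⟨ lookup-∘ₚ σ τ _ ⟩
      lookup σ (lookup τ (lookup (τ′ ∘ₚ σ′) i))      ≡⟨ cong (lookup σ ∘ lookup τ) (lookup-∘ₚ τ′ σ′ i) ⟩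
      lookup σ (lookup τ (lookup τ′ (lookup σ′ i)))  ≡⟨ cong (lookup σ) (ττ′ _) ⟩
      lookup σ (lookup σ′ i)                         ≡⟨ σσ′ i ⟩
      i                                              ∎

  left-inverse⇒inverse : ∀ {σ σ′ τ : Map n} → τ ∘ₚ σ ≡ e → AreInverse σ σ′ → AreInverse τ σ
  left-inverse⇒inverse {σ} {σ′} {τ} τσ≡e (inverses _ σσ′) = inverses σ∘τ τ∘σ
    where
    τ∘σ : ∀ i → lookup τ (lookup σ i) ≡ i
    τ∘σ i = trans (sym (lookup-∘ₚ τ σ i)) (trans (cong (λ ρ → lookup ρ i) τσ≡e) (lookup-e i))
    σ∘τ : ∀ i → lookup σ (lookup τ i) ≡ i
    σ∘τ i = trans (cong (lookup σ ∘ lookup τ) (sym (σσ′ i))) (trans (cong (lookup σ) (τ∘σ _)) (σσ′ i))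

  ∘ₚ-cancelˡ : ∀ {σ τ α β : Map n} → AreInverse σ τ → σ ∘ₚ α ≡ σ ∘ₚ β → α ≡ β
  ∘ₚ-cancelˡ {σ} {τ} {α} {β} (inverses τσ _) σα≡σβ = Map-ext λ i → begin
    lookup α i                        ≡⟨ τσ _ ⟨
    lookup τ (lookup σ (lookup α i))  ≡⟨ cong (lookup τ) (σα≗σβ i) ⟩
    lookup τ (lookup σ (lookup β i))  ≡⟨ τσ _ ⟩
    lookup β i                        ∎
    where
    open ≡-Reasoning
    σα≗σβ : ∀ i → lookup σ (lookup α i) ≡ lookup σ (lookup β i)
    σα≗σβ i = trans (sym (lookup-∘ₚ σ α i)) (trans (cong (λ ρ → lookup ρ i) σα≡σβ) (lookup-∘ₚ σ β i))

  fixes-∘ₚ : ∀ {σ τ : Map n} {x} → Fixes σ x → Fixes τ x → Fixes (σ ∘ₚ τ) x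
  fixes-∘ₚ {σ} {τ} {x} σx≡x τx≡x = trans (lookup-∘ₚ σ τ x) (trans (cong (lookup σ) τx≡x) σx≡x)

  fixes-inverse : ∀ {σ τ : Map n} {x} → AreInverse σ τ → Fixes σ x → Fixes τ x
  fixes-inverse {τ = τ} {x} (inverses τσ _) σx≡x = trans (cong (lookup τ) (sym σx≡x)) (τσ x)

module _ {n : ℕ} {u v : Fin n} where

  swapFin-left : swapFin u v u ≡ v
  swapFin-left rewrite dec-true (u ≟ᶠ u) refl = refl

  swapFin-right : swapFin u v v ≡ u
  swapFin-right with v ≟ᶠ u
  ... | yes v≡u = v≡u
  ... | no  _   rewrite dec-true (v ≟ᶠ v) refl = refl

  swapFin-other : ∀ {x} → x ≢ u → x ≢ v → swapFin u v x ≡ x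
  swapFin-other {x} x≢u x≢v rewrite dec-false (x ≟ᶠ u) x≢u | dec-false (x ≟ᶠ v) x≢v = refl

  swapFin-involutive : ∀ x → swapFin u v (swapFin u v x) ≡ x
  swapFin-involutive x = by-cases x (x ≟ᶠ u) (x ≟ᶠ v)
    where
    by-cases : ∀ y → Dec (y ≡ u) → Dec (y ≡ v) → swapFin u v (swapFin u v y) ≡ y
    by-cases _ (yes refl) _          = trans (cong (swapFin u v) swapFin-left) swapFin-right
    by-cases _ (no _)     (yes refl) = trans (cong (swapFin u v) swapFin-right) swapFin-left
    by-cases _ (no y≢u)   (no y≢v)   =
      trans (cong (swapFin u v) (swapFin-other y≢u y≢v)) (swapFin-other y≢u y≢v)

  transp-inverse : AreInverse (transp u v) (transp u v)
  transp-inverse = inverses transp² transp²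
    where
    transp² : ∀ i → lookup (transp u v) (lookup (transp u v) i) ≡ i
    transp² i rewrite lookup∘tabulate (swapFin u v) i | lookup∘tabulate (swapFin u v) (swapFin u v i) =
      swapFin-involutive i

InSEP-inverse : ∀ {n} {Γ : SimpleGraph n} {σ} → InSEP Γ σ → ∃ λ τ → InSEP Γ τ × AreInverse σ τ
InSEP-inverse sep-id                 = e , sep-id , e-inverse
InSEP-inverse (sep-gen u v u≈v)      = transp u v , sep-gen u v u≈v , transp-inverse
InSEP-inverse (sep-mul σ∈ τ∈)
  with σ′ , σ′∈ , σσ′ ← InSEP-inverse σ∈ | τ′ , τ′∈ , ττ′ ← InSEP-inverse τ∈
  = τ′ ∘ₚ σ′ , sep-mul τ′∈ σ′∈ , ∘ₚ-inverse σσ′ ττ′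
InSEP-inverse (sep-inv {σ} σ∈ τσ≡e)
  with σ′ , _ , σσ′ ← InSEP-inverse σ∈
  = σ , σ∈ , left-inverse⇒inverse τσ≡e σσ′

-- Prime divisors of the order of a permutation group

record FinitePermGroup (n : ℕ) : Set where
  field
    elements       : List (Map n)
    unique         : Unique elements
    e∈             : e ∈ elements
    ∘ₚ-closed      : ∀ {σ τ} → σ ∈ elements → τ ∈ elements → σ ∘ₚ τ ∈ elements
    inverse-closed : ∀ {σ} → σ ∈ elements → ∃ λ τ → τ ∈ elements × AreInverse σ τ

module _ {n : ℕ} (G : FinitePermGroup n) where
  open FinitePermGroup G

  stabiliser : List (Fin n) → List (Map n)
  stabiliser []      = elements
  stabiliser (x ∷ R) = fibre (λ σ → lookup σ x) (stabiliser R) x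

  orbitFibre : List (Fin n) → Fin n → Fin n → List (Map n)
  orbitFibre R x = fibre (λ σ → lookup σ x) (stabiliser R)

  stabiliser-unique : ∀ R → Unique (stabiliser R)
  stabiliser-unique []      = unique
  stabiliser-unique (x ∷ R) = Unique.filter⁺ _ (stabiliser-unique R)

  ∈-stabiliser⁻ : ∀ R {σ} → σ ∈ stabiliser R → σ ∈ elements × All (Fixes σ) R
  ∈-stabiliser⁻ []      σ∈ = σ∈ , []
  ∈-stabiliser⁻ (x ∷ R) σ∈ =
    let σ∈R , σx≡x     = ∈-filter⁻ (λ σ → lookup σ x ≟ᶠ x) σ∈
        σ∈G , σ-fixes = ∈-stabiliser⁻ R σ∈R
    in σ∈G , σx≡x ∷ σ-fixes

  ∈-stabiliser⁺ : ∀ R {σ} → σ ∈ elements → All (Fixes σ) R → σ ∈ stabiliser R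
  ∈-stabiliser⁺ []      σ∈ []               = σ∈
  ∈-stabiliser⁺ (x ∷ R) σ∈ (σx≡x ∷ σ-fixes) =
    ∈-filter⁺ (λ σ → lookup σ x ≟ᶠ x) (∈-stabiliser⁺ R σ∈ σ-fixes) σx≡x

  e∈stabiliser : ∀ R → e ∈ stabiliser R
  e∈stabiliser R = ∈-stabiliser⁺ R e∈ (All.universal lookup-e R)

  inverse∈stabiliser : ∀ R {g} → g ∈ stabiliser R → ∃ λ h → h ∈ stabiliser R × AreInverse g h
  inverse∈stabiliser R g∈ =
    let g∈G , g-fixes  = ∈-stabiliser⁻ R g∈
        h , h∈G , g⁻¹h = inverse-closed g∈G
    in h , ∈-stabiliser⁺ R h∈G (All.map (fixes-inverse g⁻¹h) g-fixes) , g⁻¹h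

  ∘ₚ-∈-orbitFibre : ∀ R x {g σ y} → g ∈ stabiliser R → σ ∈ orbitFibre R x y →
    g ∘ₚ σ ∈ orbitFibre R x (lookup g y)
  ∘ₚ-∈-orbitFibre R x {g} {σ} {y} g∈ σ∈ =
    let σ∈R , σx≡y     = ∈-filter⁻ (λ τ → lookup τ x ≟ᶠ y) σ∈
        g∈G , g-fixes = ∈-stabiliser⁻ R g∈
        σ∈G , σ-fixes = ∈-stabiliser⁻ R σ∈R
    in ∈-filter⁺ (λ τ → lookup τ x ≟ᶠ lookup g y)
         (∈-stabiliser⁺ R (∘ₚ-closed g∈G σ∈G) (All.zipWith (λ (gs , σs) → fixes-∘ₚ {σ = g} {σ} gs σs) (g-fixes , σ-fixes)))
         (trans (lookup-∘ₚ g σ x) (cong (lookup g) σx≡y))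

  orbitFibre-length-≤ : ∀ R x {g y} → g ∈ stabiliser R →
    length (orbitFibre R x y) ≤ length (orbitFibre R x (lookup g y))
  orbitFibre-length-≤ R x g∈ =
    let _ , _ , g⁻¹h = inverse∈stabiliser R g∈
    in length-≤-by-injection (Unique.filter⁺ _ (stabiliser-unique R)) _ (∘ₚ-cancelˡ g⁻¹h) (∘ₚ-∈-orbitFibre R x g∈)

  -- An element g of the fibre over y translates the fibre over x onto it, and g⁻¹ translates back.
  orbitFibre-length : ∀ R x {g y} → g ∈ orbitFibre R x y →
    length (orbitFibre R x y) ≡ length (stabiliser (x ∷ R))
  orbitFibre-length R x {g} {y} g∈ =
    let g∈R , gx≡y   = ∈-filter⁻ (λ τ → lookup τ x ≟ᶠ y) g∈
        h , h∈R , g⁻¹h = inverse∈stabiliser R g∈R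
        hy≡x         = trans (cong (lookup h) (sym gx≡y)) (AreInverse.after g⁻¹h x)
    in ℕ.≤-antisym
         (subst (λ z → length (orbitFibre R x y) ≤ length (orbitFibre R x z)) hy≡x (orbitFibre-length-≤ R x h∈R))
         (subst (λ z → length (orbitFibre R x x) ≤ length (orbitFibre R x z)) gx≡y (orbitFibre-length-≤ R x g∈R))

  stabiliser-index : ∀ R x → ∃ λ c → NonZero c × c ≤ n × length (stabiliser R) ≡ c * length (stabiliser (x ∷ R))
  stabiliser-index R x =
    let c , c≤n , |G_R|≡c*|G_xR| =
          length-by-equal-fibres (λ σ → lookup σ x) (stabiliser R) _ (λ _ g∈ → orbitFibre-length R x g∈)
        |G_R|≢0 = >-nonZero (∈-length (e∈stabiliser R))
    in c , ℕ.m*n≢0⇒m≢0 c {{subst NonZero |G_R|≡c*|G_xR| |G_R|≢0}} , c≤n , |G_R|≡c*|G_xR|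

  length-stabiliser-allFin : length (stabiliser (allFin n)) ≡ 1
  length-stabiliser-allFin = ℕ.≤-antisym
    (length-≤-by-injection (stabiliser-unique (allFin n)) id id only-e)
    (∈-length (e∈stabiliser (allFin n)))
    where
    only-e : ∀ {σ} → σ ∈ stabiliser (allFin n) → σ ∈ e ∷ []
    only-e σ∈ = here (Map-ext λ i →
      trans (All.lookup (proj₂ (∈-stabiliser⁻ (allFin n) σ∈)) (∈-allFin i)) (sym (lookup-e i)))

  module _ {p : ℕ} (p-prime : Prime p) where

    prime∣order⇒≤degree⊎∣stabiliser : ∀ R → p ∣ length elements → p ≤ n ⊎ p ∣ length (stabiliser R)
    prime∣order⇒≤degree⊎∣stabiliser []      p∣|G| = inj₂ p∣|G|
    prime∣order⇒≤degree⊎∣stabiliser (x ∷ R) p∣|G| with prime∣order⇒≤degree⊎∣stabiliser R p∣|G|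
    ... | inj₁ p≤n     = inj₁ p≤n
    ... | inj₂ p∣|G_R| =
      let c , c≢0 , c≤n , |G_R|≡c*|G_xR| = stabiliser-index R x
      in map₁ (λ p∣c → ℕ.≤-trans (∣⇒≤ {{c≢0}} p∣c) c≤n)
           (euclidsLemma c _ p-prime (subst (p ∣_) |G_R|≡c*|G_xR| p∣|G_R|))

    prime∣order⇒≤degree : p ∣ length elements → p ≤ n
    prime∣order⇒≤degree p∣|G| with prime∣order⇒≤degree⊎∣stabiliser (allFin n) p∣|G|
    ... | inj₁ p≤n = p≤n
    ... | inj₂ p∣1 = ⊥-elim (¬prime[1] (subst Prime (∣1⇒≡1 (subst (p ∣_) length-stabiliser-allFin p∣1)) p-prime))

SEP-group : ∀ {n} (Γ : SimpleGraph n) (l : List (Map n)) → Unique l → (∀ σ → σ ∈ l ⇔ InSEP Γ σ) →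
  FinitePermGroup n
SEP-group Γ l l-unique l⇔SEP = record
  { elements       = l
  ; unique         = l-unique
  ; e∈             = from sep-id
  ; ∘ₚ-closed      = λ σ∈ τ∈ → from (sep-mul (to σ∈) (to τ∈))
  ; inverse-closed = λ σ∈ → let τ , τ∈SEP , σ⁻¹τ = InSEP-inverse (to σ∈) in τ , from τ∈SEP , σ⁻¹τ
  }
  where
  to : ∀ {σ} → σ ∈ l → InSEP Γ σ
  to {σ} = Equivalence.to (l⇔SEP σ)
  from : ∀ {σ} → InSEP Γ σ → σ ∈ l
  from {σ} = Equivalence.from (l⇔SEP σ)

injection-into-[2,n]⇒n≡0 : ∀ {n} (f : Fin n → ℕ) → (∀ i j → f i ≡ f j → i ≡ j) →
  (∀ i → 2 ≤ f i × f i ≤ n) → n ≡ 0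
injection-into-[2,n]⇒n≡0 {zero}  _ _ _ = refl
injection-into-[2,n]⇒n≡0 {suc m} f f-injective bounds = ⊥-elim (ℕ.1+n≰n (injective⇒≤ g-injective))
  where
  f∸2<m : ∀ i → f i ∸ 2 < m
  f∸2<m i = ℕ.∸-monoˡ-< (s≤s (proj₂ (bounds i))) (proj₁ (bounds i))
  g : Fin (suc m) → Fin m
  g i = fromℕ< (f∸2<m i)
  g-injective : ∀ {i j} → g i ≡ g j → i ≡ j
  g-injective {i} {j} gi≡gj = f-injective i j
    (ℕ.∸-cancelʳ-≡ (proj₁ (bounds i)) (proj₁ (bounds j)) (fromℕ<-injective _ _ (f∸2<m i) (f∸2<m j) gi≡gj))

corollary3p5 : (n : ℕ) → 1 ≤ n → (Γ : SimpleGraph n) → (N : ℕ) →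
    HasOrder Γ N → ¬ IsoToPrimeGraph Γ N
corollary3p5 n 1≤n Γ _ (l , l-unique , l⇔SEP , refl) (f , f-vertex , f-injective , _ , _) =
  ℕ.<⇒≢ 1≤n (sym (injection-into-[2,n]⇒n≡0 f f-injective bounds))
  where
  bounds : ∀ i → 2 ≤ f i × f i ≤ n
  bounds i =
    let f[i]-prime , f[i]∣|SEP| = f-vertex i
    in nonTrivial⇒n>1 (f i) {{prime⇒nonTrivial f[i]-prime}} ,
       prime∣order⇒≤degree (SEP-group Γ l l-unique l⇔SEP) f[i]-prime f[i]∣|SEP|
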